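{- An oriented Burling graph has no directed cycle.
   Context: Rooted trees: for a rooted tree $(T,r)$ and $v\neq r$, $p(v)$ is the parent of $v$. A branch is a path $v_1v_2\dots v_k$ of $T$ with $v_i$ the parent of $v_{i+1}$ for all $i$ (it starts at $v_1$); a branch may be empty. A Burling tree is a 4-tuple $(T,r,\ell,c)$ where $T$ is a rooted tree with root $r$; $\ell$ assigns to every non-leaf vertex $v$ one of its children $\ell(v)$, the last-born of $v$; and $c$ is a function on $V(T)$ such that if $v\neq r$ is not a last-born then $c(v)$ is the vertex set of a (possibly empty) branch of $T$ starting at $\ell(p(v))$, while $c(v)=\varnothing$ if $v$ is the root or a last-born. The oriented graph fully derived from the Burling tree has vertex set $V(T)$ and an arc $uv$ iff $v\in c(u)$. An oriented graph is derived from the Burling tree if it is an induced subgraph of the fully derived oriented graph; an oriented Burling graph is an oriented graph derived from some Burling tree. -}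

module Defs where

open import Data.Nat using (ℕ; _≤_)
open import Data.Fin using (Fin)
open import Data.Maybe using (Maybe; just; nothing)
open import Data.List using (List; []; _∷_; _++_; [_]; length)
open import Data.List.Membership.Propositional using (_∈_)
open import Data.List.Relation.Unary.Unique.Propositional using (Unique)
open import Data.Product using (Σ; _×_; ∃)
open import Data.Sum using (_⊎_)
open import Relation.Binary.PropositionalEquality using (_≡_; _≢_)
open import Relation.Nullary using (¬_)
open import Function.Definitions using (Injective)
open import Level using (0ℓ)

-- Rooted trees on the vertex set Fin n, given by parent pointers.
-- par v ≡ nothing  iff  v is the root;  par v ≡ just u  iff  u is the parent of v.

data ReachesTop {n : ℕ} (par : Fin n → Maybe (Fin n)) : Fin n → Set where
  top  : ∀ {v} → par v ≡ nothing → ReachesTop par v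
  step : ∀ {v u} → par v ≡ just u → ReachesTop par u → ReachesTop par v

record RootedTree (n : ℕ) : Set where
  field
    root      : Fin n
    par       : Fin n → Maybe (Fin n)
    root-top  : par root ≡ nothing
    only-root : ∀ v → par v ≡ nothing → v ≡ root
    reaches   : ∀ v → ReachesTop par v

data IsBranch {n : ℕ} (par : Fin n → Maybe (Fin n)) : List (Fin n) → Set where
  []   : IsBranch par []
  [_]′ : ∀ x → IsBranch par (x ∷ [])
  _∷ᵇ_ : ∀ {x y rest} → par y ≡ just x → IsBranch par (y ∷ rest) → IsBranch par (x ∷ y ∷ rest)

BranchFrom : {n : ℕ} → (Fin n → Maybe (Fin n)) → Fin n → List (Fin n) → Set
BranchFrom par a []        = IsBranch par []
BranchFrom par a (x ∷ xs)  = (x ≡ a) × IsBranch par (x ∷ xs)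

record BurlingTree (n : ℕ) : Set where
  field
    tree : RootedTree n
  open RootedTree tree public
  field
    -- last-born ℓ(v); only meaningful (and constrained) when v is not a leaf
    lb    : Fin n → Fin n
    lb-child : ∀ v → (∃ λ w → par w ≡ just v) → par (lb v) ≡ just v
    c     : Fin n → List (Fin n)
    c-root : c root ≡ []
    c-lastborn : ∀ v u → par v ≡ just u → lb u ≡ v → c v ≡ []
    c-other : ∀ v u → par v ≡ just u → lb u ≢ v → BranchFrom par (lb u) (c v)

Graph : ℕ → Set₁
Graph m = Fin m → Fin m → Set

fullyDerived : {n : ℕ} → BurlingTree n → Graph n
fullyDerived B u v = v ∈ BurlingTree.c B u

InducedSubgraphOf : {m n : ℕ} → Graph m → Graph n → Set
InducedSubgraphOf {m} {n} G H =
  Σ (Fin m → Fin n) λ f → Injective _≡_ _≡_ f ×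
    (∀ u v → (G u v → H (f u) (f v)) × (H (f u) (f v) → G u v))

DerivedFrom : {m n : ℕ} → Graph m → BurlingTree n → Set
DerivedFrom G B = InducedSubgraphOf G (fullyDerived B)

OrientedBurling : {m : ℕ} → Graph m → Set
OrientedBurling G = Σ ℕ λ n → Σ (BurlingTree n) λ B → DerivedFrom G B

data Walk {m : ℕ} (G : Graph m) : List (Fin m) → Set where
  []   : Walk G []
  [_]′ : ∀ x → Walk G (x ∷ [])
  _∷ʷ_ : ∀ {x y rest} → G x y → Walk G (y ∷ rest) → Walk G (x ∷ y ∷ rest)

DirectedCycle : {m : ℕ} → Graph m → Set
DirectedCycle {m} G =
  Σ (Fin m) λ x → Σ (List (Fin m)) λ xs →
    (1 ≤ length xs) × Unique (x ∷ xs) × Walk G (x ∷ xs ++ [ x ])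

{-# OPTIONS --safe #-}
-- Along an arc u → v whose head v has an out-arc, the depth strictly increases:
-- v lies on a branch starting at the last-born sibling ℓ(p(u)) of u, which has the
-- depth of u, and v cannot be ℓ(p(u)) itself because last-borns have no out-arcs.
-- Around a directed cycle every vertex has an out-arc, so the depth would increase
-- strictly all the way around, which is absurd.
module Submission where

open import Defs
open import Data.Empty using (⊥-elim)
open import Data.Nat using (ℕ; suc; _≤_; _<_)
open import Data.Nat.Properties using (≤-refl; ≤-trans; <-≤-trans; <⇒≤; <-irrefl; n<1+n)
open import Data.Fin using (Fin)
open import Data.Maybe using (just; nothing)
open import Data.Maybe.Properties using (just-injective)
open import Data.List using ([]; _∷_; _++_; [_])
open import Data.List.Relation.Unary.Any using (here; there)
open import Data.List.Membership.Propositional using (_∈_)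
open import Data.Product using (∃; _,_; proj₁; proj₂)
open import Data.Sum using (_⊎_; inj₁; inj₂)
open import Relation.Binary.PropositionalEquality using (_≡_; _≢_; refl; sym; trans; cong; subst)
open import Relation.Nullary using (¬_)
open import Function using (_∘_)

module Depth {n : ℕ} (B : BurlingTree n) where
  open BurlingTree B

  length-to-top : ∀ {v} → ReachesTop par v → ℕ
  length-to-top (top _)    = 0
  length-to-top (step _ r) = suc (length-to-top r)

  length-to-top-unique : ∀ {v} (p q : ReachesTop par v) → length-to-top p ≡ length-to-top q
  length-to-top-unique (top _)    (top _)     = refl
  length-to-top-unique (top e)    (step e′ _) with () ← trans (sym e) e′
  length-to-top-unique (step e _) (top e′)    with () ← trans (sym e′) e
  length-to-top-unique (step e p) (step e′ q) with refl ← just-injective (trans (sym e) e′) =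
    cong suc (length-to-top-unique p q)

  depth : Fin n → ℕ
  depth v = length-to-top (reaches v)

  depth-child : ∀ {v u} → par v ≡ just u → depth v ≡ suc (depth u)
  depth-child {v} {u} e = length-to-top-unique (reaches v) (step e (reaches u))

  depth-parent-< : ∀ {v u} → par v ≡ just u → depth u < depth v
  depth-parent-< {v} {u} e = subst (depth u <_) (sym (depth-child e)) (n<1+n (depth u))

  branch-head-≤ : ∀ {x xs v} → IsBranch par (x ∷ xs) → v ∈ x ∷ xs → depth x ≤ depth v
  branch-head-< : ∀ {x xs v} → IsBranch par (x ∷ xs) → v ∈ xs → depth x < depth v

  branch-head-≤ b        (here refl) = ≤-refl
  branch-head-≤ b        (there v∈)  = <⇒≤ (branch-head-< b v∈)

  branch-head-< (e ∷ᵇ b) v∈ = <-≤-trans (depth-parent-< e) (branch-head-≤ b v∈)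

  branchFrom-∈ : ∀ {a xs v} → BranchFrom par a xs → v ∈ xs → v ≡ a ⊎ depth a < depth v
  branchFrom-∈ (refl , b) (here refl) = inj₁ refl
  branchFrom-∈ (refl , b) (there v∈)  = inj₂ (branch-head-< b v∈)

  no-arc-from : ∀ {u w} → c u ≡ [] → ¬ w ∈ c u
  no-arc-from c≡[] w∈ with () ← subst (_ ∈_) c≡[] w∈

  arc-source-has-parent : ∀ {u v} → v ∈ c u → ∃ λ p → par u ≡ just p
  arc-source-has-parent {u} v∈ with par u in pu
  ... | just p  = p , refl
  ... | nothing = ⊥-elim (no-arc-from (subst (λ x → c x ≡ []) (sym (only-root u pu)) c-root) v∈)

  arc-source-not-lastborn : ∀ {u p v} → par u ≡ just p → v ∈ c u → lb p ≢ u
  arc-source-not-lastborn pu v∈ lbu = no-arc-from (c-lastborn _ _ pu lbu) v∈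

  no-arc-from-lastborn : ∀ {u p w} → par u ≡ just p → ¬ w ∈ c (lb p)
  no-arc-from-lastborn {u} {p} pu = no-arc-from (c-lastborn (lb p) p (lb-child p (u , pu)) refl)

  arc-depth-< : ∀ {u v w} → v ∈ c u → w ∈ c v → depth u < depth v
  arc-depth-< {u} v∈ w∈ with p , pu ← arc-source-has-parent v∈
    with branchFrom-∈ (c-other u p pu (arc-source-not-lastborn pu v∈)) v∈
  ... | inj₁ refl = ⊥-elim (no-arc-from-lastborn pu w∈)
  ... | inj₂ lb<v = subst (_< _) (sym same-depth) lb<v
    where
      same-depth : depth u ≡ depth (lb p)
      same-depth = trans (depth-child pu) (sym (depth-child (lb-child p (u , pu))))

module Potential {m : ℕ} {G : Graph m} (h : Fin m → ℕ)
  (h-increasing : ∀ {a b c} → G a b → G b c → h a < h b) where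

  HasOutArc : Fin m → Set
  HasOutArc a = ∃ λ b → G a b

  walk-head-has-out-arc : ∀ {a z} ws → Walk G (a ∷ ws ++ [ z ]) → HasOutArc a
  walk-head-has-out-arc []      (e ∷ʷ _) = _ , e
  walk-head-has-out-arc (_ ∷ _) (e ∷ʷ _) = _ , e

  walk-h-≤ : ∀ {a z} ws → Walk G (a ∷ ws ++ [ z ]) → HasOutArc z → h a ≤ h z
  walk-h-≤ []       (e ∷ʷ _) (_ , e′) = <⇒≤ (h-increasing e e′)
  walk-h-≤ (_ ∷ ws) (e ∷ʷ w) z-out    =
    ≤-trans (<⇒≤ (h-increasing e (proj₂ (walk-head-has-out-arc ws w)))) (walk-h-≤ ws w z-out)

  no-directed-cycle : ¬ DirectedCycle G
  no-directed-cycle (x , y ∷ ys , _ , _ , e ∷ʷ w) =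
    <-irrefl refl (<-≤-trans (h-increasing e (proj₂ (walk-head-has-out-arc ys w))) (walk-h-≤ ys w (_ , e)))

lemma3p2 : {m : ℕ} (G : Graph m) → OrientedBurling G → ¬ DirectedCycle G
lemma3p2 G (n , B , f , _ , induced) = Potential.no-directed-cycle (depth ∘ f) depth-increases-along-G
  where
    open Depth B
    depth-increases-along-G : ∀ {a b c} → G a b → G b c → depth (f a) < depth (f b)
    depth-increases-along-G ab bc = arc-depth-< (proj₁ (induced _ _) ab) (proj₁ (induced _ _) bc)
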